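{- Let $m,n\ge1$ be integers, $G=\{0,\dots,m-1\}\times\{0,\dots,n-1\}$ the $m\times n$ rectangular graph, $c=\gcd(m+1,n+1)-1$, and let $\beta,\omega$ be the dimensions of $\ker BW_{m,n}$ and $\ker WB_{m,n}$. Let $v\in\ker BW_{m,n}$ (resp. $v\in\ker WB_{m,n}$). Then: (i) $v$ vanishes identically on the grid $\mathcal{G}$; (ii) the restriction of $v$ to each fundamental square $S$ lies in the kernel of the black-to-white (resp. white-to-black) adjacency map of the subgraph of $G$ induced on $S$, with colors inherited from $G$; (iii) if $S_1,S_2$ are two fundamental squares separated by a common row $y=y_0$ or column $x=x_0$ of $\mathcal{G}$, then the restrictions of $v$ to $S_1$ and $S_2$ are mirror images of each other with respect to that row or column, i.e. $v(p)=v(p')$ for $p\in S_1$, where $p'\in S_2$ is the reflection of $p$ across that line; (iv) $\beta=\dim\ker BW_{c,c}$ and $\omega=\dim\ker WB_{c,c}$.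
   Context: Points $(x,y),(x',y')$ of a rectangular graph are adjacent iff $|x-x'|+|y-y'|=1$; a point is black if $x+y$ is even and white otherwise. For the $p\times q$ rectangular graph $\{0,\dots,p-1\}\times\{0,\dots,q-1\}$, $BW_{p,q}$ is the linear map over $\mathbb{Z}/(2)$ sending a function $u$ on black points to the function on white points $w\mapsto\sum_{b\text{ black neighbor of }w}u(b)\pmod 2$, and $WB_{p,q}$ is defined symmetrically from white points to black points (for $c=0$ the $0\times0$ graph is empty and these kernels are $0$). The grid $\mathcal{G}$ of $G$ is the set of points of $G$ lying on a horizontal line $y=k(c+1)-1$ or a vertical line $x=k(c+1)-1$ for some integer $k$. Since $c+1$ divides $m+1$ and $n+1$, $G\setminus\mathcal{G}$ is the disjoint union of the $c\times c$ squares $\{k(c+1),\dots,k(c+1)+c-1\}\times\{l(c+1),\dots,l(c+1)+c-1\}$ contained in $G$; these are the fundamental squares. -}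

module Defs where

open import Data.Nat using (ℕ; zero; suc; _+_; _*_; _∸_; _≤_; _≤ᵇ_; _<ᵇ_; _%_)
open import Data.Nat.GCD using (gcd)
open import Data.Bool using (Bool; true; false; _∧_; _xor_; if_then_else_)
open import Data.Fin using (Fin) renaming (zero to fz; suc to fs)
open import Data.Product using (Σ; _×_; ∃)
open import Data.Sum using (_⊎_)
open import Relation.Binary.PropositionalEquality using (_≡_)

-- A function "on the black (resp. white) points of the p×q graph" is encoded
-- as an Fn supported on those points (value false everywhere else).
Fn : Set
Fn = ℕ → ℕ → Bool

inR : ℕ → ℕ → ℕ → ℕ → ℕ → ℕ → Bool
inR a b p q x y = (a ≤ᵇ x) ∧ (x <ᵇ a + p) ∧ (b ≤ᵇ y) ∧ (y <ᵇ b + q)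

-- colour of a point: parity of x+y (0 = black, 1 = white)
colour : ℕ → ℕ → ℕ
colour x y = (x + y) % 2

nbSum : ℕ → ℕ → ℕ → ℕ → Fn → ℕ → ℕ → Bool
nbSum a b p q v x y =
  ((1 ≤ᵇ x) ∧ inR a b p q (x ∸ 1) y ∧ v (x ∸ 1) y)
  xor ((inR a b p q (suc x) y ∧ v (suc x) y)
  xor (((1 ≤ᵇ y) ∧ inR a b p q x (y ∸ 1) ∧ v x (y ∸ 1))
  xor (inR a b p q x (suc y) ∧ v x (suc y))))

Supported : ℕ → ℕ → ℕ → Fn → Set
Supported s p q v = ∀ x y → v x y ≡ true → (inR 0 0 p q x y ≡ true) × (colour x y ≡ s)

-- kernel of the adjacency map from colour s to colour t on the rectangle
-- {a,…,a+p-1}×{b,…,b+q-1} (colours inherited from absolute parity):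
-- for every point w of colour t in the rectangle, the sum of v over neighbours
-- of w in the rectangle vanishes.
KerCond : ℕ → ℕ → ℕ → ℕ → ℕ → Fn → Set
KerCond t a b p q v = ∀ x y → inR a b p q x y ≡ true → colour x y ≡ t → nbSum a b p q v x y ≡ false

KerBW : ℕ → ℕ → Fn → Set
KerBW p q v = Supported 0 p q v × KerCond 1 0 0 p q v

KerWB : ℕ → ℕ → Fn → Set
KerWB p q v = Supported 1 p q v × KerCond 0 0 0 p q v

comb : {k : ℕ} → (Fin k → Bool) → (Fin k → Fn) → Fn
comb {zero} c B x y = false
comb {suc k} c B x y = (c fz ∧ B fz x y) xor comb (λ i → c (fs i)) (λ i → B (fs i)) x y

IsDim : (Fn → Set) → ℕ → Set
IsDim P k = Σ (Fin k → Fn) λ B →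
    (∀ i → P (B i))
  × (∀ (c : Fin k → Bool) → (∀ x y → comb c B x y ≡ false) → ∀ i → c i ≡ false)
  × (∀ u → P u → ∃ λ (c : Fin k → Bool) → ∀ x y → u x y ≡ comb c B x y)

cOf : ℕ → ℕ → ℕ
cOf m n = gcd (suc m) (suc n) ∸ 1

InGrid : ℕ → ℕ → ℕ → Set
InGrid c x y = (∃ λ k → suc x ≡ k * suc c) ⊎ (∃ λ k → suc y ≡ k * suc c)

Props : ℕ → ℕ → ℕ → ℕ → Fn → Set
Props t m n c v =
    (∀ x y → inR 0 0 m n x y ≡ true → InGrid c x y → v x y ≡ false)
  × (∀ k l → k * suc c + c ≤ m → l * suc c + c ≤ n →
        KerCond t (k * suc c) (l * suc c) c c v)
  -- (iii-a) squares S_{k,l}, S_{k+1,l} separated by column x0 = (k+1)(c+1)-1: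
  --        v(x,y) = v(2 x0 - x, y) for (x,y) in S_{k,l}
  × (∀ k l → suc k * suc c + c ≤ m → l * suc c + c ≤ n → ∀ x y →
        inR (k * suc c) (l * suc c) c c x y ≡ true →
        v x y ≡ v (2 * (suc k * suc c ∸ 1) ∸ x) y)
  -- (iii-b) squares S_{k,l}, S_{k,l+1} separated by row y0 = (l+1)(c+1)-1
  × (∀ k l → k * suc c + c ≤ m → suc l * suc c + c ≤ n → ∀ x y →
        inR (k * suc c) (l * suc c) c c x y ≡ true →
        v x y ≡ v x (2 * (suc l * suc c ∸ 1) ∸ y))

{-# OPTIONS --safe #-}
module Submission where

-- Mod 2 the adjacency map of the grid graph is its discrete Laplacian, and an element v of
-- ker BW or ker WB lies in its kernel, because v vanishes at every neighbour of a point of its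
-- own colour.  Padded with zeros to [0, m + 1] × [0, n + 1], v solves a discrete wave equation
-- whose solutions are determined by two consecutive rows, so v agrees there with the d'Alembert
-- function Φ(X + Y) + Φ(X − Y) of an even Φ read off from its first row.  The zero boundary
-- values make Φ symmetric about m + 1 and about n + 1.  The centres of symmetry of an even
-- function form a subgroup of ℤ, so Φ is symmetric about every multiple of
-- gcd(m + 1, n + 1) = c + 1: this gives (i) and (iii), and (ii) because v vanishes on the grid
-- around each fundamental square.  Conversely every even Φ symmetric about c + 1 yields a kernel
-- element.  On the colour class s only the values of Φ at the integers ≡ s (mod 2) of [0, c + 1]
-- matter, and only up to a constant, so the kernel has dimension ⌊(c + 1 − s)/2⌋ (s = 0 for
-- ker BW, s = 1 for ker WB), which depends on m and n only through c.

open import Algebra.Bundles using (CommutativeRing)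
open import Data.Bool using (Bool; true; false; not; _∧_; _xor_)
open import Data.Bool.Properties
  using ( xor-same; xor-assoc; xor-comm; xor-identityʳ; not-injective; not-involutive
        ; ∧-zeroʳ; ∧-identityʳ; ∧-assoc; ∧-comm; ∧-distribˡ-xor; T-≡; xor-∧-commutativeRing)
open import Algebra.Properties.CommutativeSemigroup (CommutativeRing.+-commutativeSemigroup xor-∧-commutativeRing)
  using (interchange)
open import Data.Product using (_×_; _,_; proj₁; proj₂; ∃)
open import Data.Sum using (_⊎_; inj₁; inj₂)
open import Function using (_∘_)
open import Function.Bundles using (_⇔_; mk⇔; Equivalence)
open import Relation.Nullary using (¬_; yes; no; contradiction)
open import Relation.Binary.PropositionalEquality
open import Defs

xor-cancelˡ : ∀ a {b c} → a xor b ≡ a xor c → b ≡ c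
xor-cancelˡ false eq = eq
xor-cancelˡ true eq = not-injective eq

xor≡false⇒≡ : ∀ {a b} → a xor b ≡ false → a ≡ b
xor≡false⇒≡ {a} eq = sym (xor-cancelˡ a (trans eq (sym (xor-same a))))

≡⇒xor≡false : ∀ {a b} → a ≡ b → a xor b ≡ false
≡⇒xor≡false {a} refl = xor-same a

xor-involutiveˡ : ∀ a b → a xor (a xor b) ≡ b
xor-involutiveˡ false b = refl
xor-involutiveˡ true b = not-involutive b

xor-cancel-common : ∀ a b c → (a xor c) xor (b xor c) ≡ a xor b
xor-cancel-common a b c =
  trans (interchange a c b c) (trans (cong ((a xor b) xor_) (xor-same c)) (xor-identityʳ (a xor b)))

∧≡true : ∀ {a b} → a ∧ b ≡ true → a ≡ true × b ≡ true
∧≡true {true} {true} refl = refl , refl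

∧-redundantˡ : ∀ {a b} → (b ≡ true → a ≡ true) → a ∧ b ≡ b
∧-redundantˡ {a} {false} _ = ∧-zeroʳ a
∧-redundantˡ {a} {true} b⇒a rewrite b⇒a refl = refl

∧-congˡ-if : ∀ {a b c} → (a ≡ true → b ≡ c) → a ∧ b ≡ a ∧ c
∧-congˡ-if {false} _ = refl
∧-congˡ-if {true} eq = eq refl

-- Reflection symmetries of functions on ℤ, and d'Alembert functions

module IntegerSymmetry where
  open import Data.Nat as ℕ using (ℕ; zero; suc)
  import Data.Nat.Properties as ℕ
  open import Data.Nat.GCD using (gcd; gcd-GCD; module Bézout)
  open import Data.Nat.Divisibility using (_∣_; divides)
  open import Data.Integer using (ℤ; +_; -[1+_]; 0ℤ; _+_; _-_; -_; _*_; ∣_∣)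
  open import Data.Integer.Properties using (pos-+; pos-*; suc-*; +-identityˡ; +-comm; ∣-i∣≡∣i∣)
  open import Data.Integer.Tactic.RingSolver using (solve-∀)
  open ≡-Reasoning

  record SymmetricAbout {A : Set} (f : ℤ → A) (a : ℤ) : Set where
    constructor mirrored
    field mirror : ∀ z → f (a + z) ≡ f (a - z)

  open SymmetricAbout public

  symmetricAbout-∘ : ∀ {A B : Set} {f : ℤ → A} {a} (g : A → B) → SymmetricAbout f a → SymmetricAbout (λ z → g (f z)) a
  symmetricAbout-∘ g sa = mirrored λ z → cong g (mirror sa z)

  symmetricAbout-of-ℕ : ∀ {A : Set} {f : ℤ → A} {a} → (∀ w → f (a + + w) ≡ f (a - + w)) → SymmetricAbout f a
  symmetricAbout-of-ℕ sym-ℕ = mirrored λ where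
    (+ w)    → sym-ℕ w
    -[1+ w ] → sym (sym-ℕ (suc w))

  module _ {A : Set} {f : ℤ → A} where

    symmetricAbout-reflect : ∀ {k} → SymmetricAbout f k → ∀ z → f (k + (k - z)) ≡ f z
    symmetricAbout-reflect {k} sk z = trans (mirror sk (k - z)) (cong f (k-[k-z]≡z k z))
      where
      k-[k-z]≡z : ∀ k z → k - (k - z) ≡ z
      k-[k-z]≡z = solve-∀

    symmetricAbout-periodic : ∀ {p} → SymmetricAbout f 0ℤ → SymmetricAbout f p → ∀ z → f (z + (p + p)) ≡ f z
    symmetricAbout-periodic {p} even sp z = begin
      f (z + (p + p))   ≡⟨ cong f (shift₁ p z) ⟩
      f (p + (z + p))   ≡⟨ mirror sp (z + p) ⟩
      f (p - (z + p))   ≡⟨ cong f (shift₂ p z) ⟩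
      f (0ℤ - z)        ≡⟨ mirror even z ⟨
      f (0ℤ + z)        ≡⟨ cong f (+-identityˡ z) ⟩
      f z               ∎
      where
      shift₁ : ∀ p z → z + (p + p) ≡ p + (z + p)
      shift₁ = solve-∀
      shift₂ : ∀ p z → p - (z + p) ≡ 0ℤ - z
      shift₂ = solve-∀

    symmetricAbout-0⇒abs : SymmetricAbout f 0ℤ → ∀ z → f z ≡ f (+ ∣ z ∣)
    symmetricAbout-0⇒abs even (+ w) = refl
    symmetricAbout-0⇒abs even -[1+ w ] = sym (mirror even (+ suc w))

  bézout-difference : ∀ {d} x m y n → d ℕ.+ y ℕ.* n ≡ x ℕ.* m → + x * + m - + y * + n ≡ + d
  bézout-difference {d} x m y n eq = begin
    + x * + m - + y * + n        ≡⟨ cong₂ _-_ (pos-* x m) (pos-* y n) ⟨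
    + (x ℕ.* m) - + (y ℕ.* n)    ≡⟨ cong (λ k → + k - + (y ℕ.* n)) eq ⟨
    + (d ℕ.+ y ℕ.* n) - + (y ℕ.* n) ≡⟨ cong (_- + (y ℕ.* n)) (pos-+ d (y ℕ.* n)) ⟩
    (+ d + + (y ℕ.* n)) - + (y ℕ.* n) ≡⟨ cancel (+ d) (+ (y ℕ.* n)) ⟩
    + d ∎
    where
    cancel : ∀ a b → (a + b) - b ≡ a
    cancel = solve-∀

  -- When 0 is a centre of symmetry, the centres of symmetry form a subgroup of ℤ.
  module _ {A : Set} {f : ℤ → A} (even : SymmetricAbout f 0ℤ) where

    symmetricAbout-difference : ∀ {a b} → SymmetricAbout f a → SymmetricAbout f b → SymmetricAbout f (a - b)
    symmetricAbout-difference {a} {b} sa sb = mirrored λ z → begin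
      f ((a - b) + z)       ≡⟨ cong f (shift₁ a b z) ⟩
      f (a + (z - b))       ≡⟨ mirror sa (z - b) ⟩
      f (a - (z - b))       ≡⟨ cong f (shift₂ a b z) ⟩
      f (b + (a - z))       ≡⟨ mirror sb (a - z) ⟩
      f (b - (a - z))       ≡⟨ cong f (shift₃ a b z) ⟩
      f (0ℤ - ((a - b) - z)) ≡⟨ mirror even ((a - b) - z) ⟨
      f (0ℤ + ((a - b) - z)) ≡⟨ cong f (+-identityˡ ((a - b) - z)) ⟩
      f ((a - b) - z)       ∎
      where
      shift₁ : ∀ a b z → (a - b) + z ≡ a + (z - b)
      shift₁ = solve-∀
      shift₂ : ∀ a b z → a - (z - b) ≡ b + (a - z)
      shift₂ = solve-∀
      shift₃ : ∀ a b z → b - (a - z) ≡ 0ℤ - ((a - b) - z)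
      shift₃ = solve-∀

    symmetricAbout-sum : ∀ {a b} → SymmetricAbout f a → SymmetricAbout f b → SymmetricAbout f (a + b)
    symmetricAbout-sum {a} {b} sa sb =
      subst (SymmetricAbout f) (a-[0-b]≡a+b a b) (symmetricAbout-difference sa (symmetricAbout-difference even sb))
      where
      a-[0-b]≡a+b : ∀ a b → a - (0ℤ - b) ≡ a + b
      a-[0-b]≡a+b = solve-∀

    symmetricAbout-multiple : ∀ k {a} → SymmetricAbout f a → SymmetricAbout f (+ k * a)
    symmetricAbout-multiple zero sa = even
    symmetricAbout-multiple (suc k) {a} sa =
      subst (SymmetricAbout f) (sym (suc-* (+ k) a)) (symmetricAbout-sum sa (symmetricAbout-multiple k sa))

    symmetricAbout-gcd : ∀ {m n} → SymmetricAbout f (+ m) → SymmetricAbout f (+ n) → SymmetricAbout f (+ gcd m n)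
    symmetricAbout-gcd {m} {n} sm sn with Bézout.identity (gcd-GCD m n)
    ... | Bézout.+- x y eq = subst (SymmetricAbout f) (bézout-difference x m y n eq)
            (symmetricAbout-difference (symmetricAbout-multiple x sm) (symmetricAbout-multiple y sn))
    ... | Bézout.-+ x y eq = subst (SymmetricAbout f) (bézout-difference y n x m eq)
            (symmetricAbout-difference (symmetricAbout-multiple y sn) (symmetricAbout-multiple x sm))

    symmetricAbout-dividing : ∀ {d n} → SymmetricAbout f (+ d) → d ∣ n → SymmetricAbout f (+ n)
    symmetricAbout-dividing {d} sd (divides q refl) = subst (SymmetricAbout f) (sym (pos-* q d)) (symmetricAbout-multiple q sd)

  evenExtension : {A : Set} → (ℕ → A) → ℤ → A
  evenExtension φ z = φ ∣ z ∣

  evenExtension-even : ∀ {A : Set} (φ : ℕ → A) → SymmetricAbout (evenExtension φ) 0ℤ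
  evenExtension-even φ = mirrored λ z → cong φ (begin
    ∣ 0ℤ + z ∣     ≡⟨ cong ∣_∣ (+-identityˡ z) ⟩
    ∣ z ∣          ≡⟨ ∣-i∣≡∣i∣ z ⟨
    ∣ - z ∣        ≡⟨ cong ∣_∣ (+-identityˡ (- z)) ⟨
    ∣ 0ℤ - z ∣     ∎)

  dAlembert : (ℤ → Bool) → ℤ → ℤ → Bool
  dAlembert Φ x y = Φ (x + y) xor Φ (x - y)

  module _ (Φ : ℤ → Bool) where

    dAlembert-horizontal≡vertical : ∀ x y →
      dAlembert Φ x (+ 1 + y) xor dAlembert Φ (+ 2 + x) (+ 1 + y)
        ≡ dAlembert Φ (+ 1 + x) y xor dAlembert Φ (+ 1 + x) (+ 2 + y)
    dAlembert-horizontal≡vertical x y = begin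
      (Φ (x + (+ 1 + y)) xor Φ (x - (+ 1 + y))) xor (Φ ((+ 2 + x) + (+ 1 + y)) xor Φ ((+ 2 + x) - (+ 1 + y)))
        ≡⟨ cong₂ _xor_ (cong (_xor b) (cong Φ (shift₁ x y)))
                       (cong₂ _xor_ (cong Φ (shift₂ x y)) (cong Φ (shift₃ x y))) ⟩
      (a xor b) xor (c xor d)   ≡⟨ interchange a b c d ⟩
      (a xor c) xor (b xor d)   ≡⟨ cong ((a xor c) xor_) (xor-comm b d) ⟩
      (a xor c) xor (d xor b)   ≡⟨ interchange a c d b ⟩
      (a xor d) xor (c xor b)
        ≡⟨ cong₂ _xor_ (cong₂ _xor_ (cong Φ (shift₄ x y)) (cong Φ (shift₅ x y)))
                       (cong₂ _xor_ (cong Φ (shift₆ x y)) (cong Φ (shift₇ x y))) ⟩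
      (Φ ((+ 1 + x) + y) xor Φ ((+ 1 + x) - y)) xor (Φ ((+ 1 + x) + (+ 2 + y)) xor Φ ((+ 1 + x) - (+ 2 + y))) ∎
      where
      a b c d : Bool
      a = Φ (+ 1 + (x + y))
      b = Φ (x - (+ 1 + y))
      c = Φ (+ 3 + (x + y))
      d = Φ (+ 1 + (x - y))
      shift₁ : ∀ x y → x + (+ 1 + y) ≡ + 1 + (x + y)
      shift₁ = solve-∀
      shift₂ : ∀ x y → (+ 2 + x) + (+ 1 + y) ≡ + 3 + (x + y)
      shift₂ = solve-∀
      shift₃ : ∀ x y → (+ 2 + x) - (+ 1 + y) ≡ + 1 + (x - y)
      shift₃ = solve-∀
      shift₄ : ∀ x y → + 1 + (x + y) ≡ (+ 1 + x) + y
      shift₄ = solve-∀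
      shift₅ : ∀ x y → + 1 + (x - y) ≡ (+ 1 + x) - y
      shift₅ = solve-∀
      shift₆ : ∀ x y → + 3 + (x + y) ≡ (+ 1 + x) + (+ 2 + y)
      shift₆ = solve-∀
      shift₇ : ∀ x y → x - (+ 1 + y) ≡ (+ 1 + x) - (+ 2 + y)
      shift₇ = solve-∀

    dAlembert-symmetricˣ : ∀ {k} → SymmetricAbout Φ k → ∀ y → SymmetricAbout (λ x → dAlembert Φ x y) k
    dAlembert-symmetricˣ {k} sk y = mirrored λ z → begin
      Φ ((k + z) + y) xor Φ ((k + z) - y)   ≡⟨ xor-comm (Φ ((k + z) + y)) _ ⟩
      Φ ((k + z) - y) xor Φ ((k + z) + y)
        ≡⟨ cong₂ _xor_ (reflected (z - y) (shift₁ k z y) (shift₂ k z y))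
                       (reflected (z + y) (shift₃ k z y) (shift₄ k z y)) ⟩
      Φ ((k - z) + y) xor Φ ((k - z) - y)   ∎
      where
      reflected : ∀ u {p q} → p ≡ k + u → k - u ≡ q → Φ p ≡ Φ q
      reflected u refl refl = mirror sk u
      shift₁ : ∀ k z y → (k + z) - y ≡ k + (z - y)
      shift₁ = solve-∀
      shift₂ : ∀ k z y → k - (z - y) ≡ (k - z) + y
      shift₂ = solve-∀
      shift₃ : ∀ k z y → (k + z) + y ≡ k + (z + y)
      shift₃ = solve-∀
      shift₄ : ∀ k z y → k - (z + y) ≡ (k - z) - y
      shift₄ = solve-∀

    dAlembert-transpose : SymmetricAbout Φ 0ℤ → ∀ x y → dAlembert Φ x y ≡ dAlembert Φ y x
    dAlembert-transpose even x y = cong₂ _xor_ (cong Φ (+-comm x y)) (begin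
      Φ (x - y)          ≡⟨ cong Φ (+-identityˡ (x - y)) ⟨
      Φ (0ℤ + (x - y))   ≡⟨ mirror even (x - y) ⟩
      Φ (0ℤ - (x - y))   ≡⟨ cong Φ ([0-[x-y]]≡y-x x y) ⟩
      Φ (y - x)          ∎)
      where
      [0-[x-y]]≡y-x : ∀ x y → 0ℤ - (x - y) ≡ y - x
      [0-[x-y]]≡y-x = solve-∀

    dAlembert-symmetricʸ : ∀ {k} → SymmetricAbout Φ 0ℤ → SymmetricAbout Φ k → ∀ x → SymmetricAbout (dAlembert Φ x) k
    dAlembert-symmetricʸ {k} even sk x = mirrored λ z → begin
      dAlembert Φ x (k + z)   ≡⟨ dAlembert-transpose even x (k + z) ⟩
      dAlembert Φ (k + z) x   ≡⟨ mirror (dAlembert-symmetricˣ sk x) z ⟩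
      dAlembert Φ (k - z) x   ≡⟨ dAlembert-transpose even (k - z) x ⟩
      dAlembert Φ x (k - z)   ∎

  integrate : (ℕ → Bool) → ℕ → Bool
  integrate ρ zero = false
  integrate ρ (suc zero) = false
  integrate ρ (suc (suc k)) = integrate ρ k xor ρ (suc k)

  dAlembert-integrate-row : ∀ {ρ} → ρ 0 ≡ false → ∀ x → dAlembert (evenExtension (integrate ρ)) x (+ 1) ≡ ρ ∣ x ∣
  dAlembert-integrate-row ρ0 (+ zero) = sym ρ0
  dAlembert-integrate-row {ρ} ρ0 (+ suc k) =
    trans (cong (λ w → integrate ρ w xor integrate ρ k) (ℕ.+-comm (suc k) 1))
          (trans (xor-comm (integrate ρ k xor ρ (suc k)) _) (xor-involutiveˡ (integrate ρ k) (ρ (suc k))))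
  dAlembert-integrate-row ρ0 -[1+ zero ] = refl
  dAlembert-integrate-row {ρ} ρ0 -[1+ suc k ] =
    trans (cong (λ w → integrate ρ (suc k) xor (integrate ρ w xor ρ (suc w))) (ℕ.+-identityʳ (suc k)))
          (xor-involutiveˡ (integrate ρ (suc k)) (ρ (suc (suc k))))

  symmetricAbout-from-row : ∀ {Φ m} → SymmetricAbout (λ x → dAlembert Φ x (+ 1)) m →
    dAlembert Φ m (+ 1) ≡ false → SymmetricAbout Φ m
  symmetricAbout-from-row {Φ} {m} row-symmetric row-m = symmetricAbout-of-ℕ symmetric-ℕ
    where
    symmetric-ℕ : ∀ w → Φ (m + + w) ≡ Φ (m - + w)
    symmetric-ℕ zero = cong Φ (m+0≡m-0 m)
      where
      m+0≡m-0 : ∀ m → m + 0ℤ ≡ m - 0ℤ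
      m+0≡m-0 = solve-∀
    symmetric-ℕ (suc zero) = xor≡false⇒≡ row-m
    symmetric-ℕ (suc (suc w)) = xor-cancelˡ (Φ (m - + w)) (begin
      Φ (m - + w) xor Φ (m + (+ 2 + + w))            ≡⟨ xor-comm (Φ (m - + w)) _ ⟩
      Φ (m + (+ 2 + + w)) xor Φ (m - + w)            ≡⟨ cong (Φ (m + (+ 2 + + w)) xor_) (symmetric-ℕ w) ⟨
      Φ (m + (+ 2 + + w)) xor Φ (m + + w)            ≡⟨ cong₂ _xor_ (cong Φ (shift₁ m (+ w))) (cong Φ (shift₂ m (+ w))) ⟩
      dAlembert Φ (m + (+ 1 + + w)) (+ 1)           ≡⟨ mirror row-symmetric (+ 1 + + w) ⟩
      dAlembert Φ (m - (+ 1 + + w)) (+ 1)           ≡⟨ cong₂ _xor_ (cong Φ (shift₃ m (+ w))) (cong Φ (shift₄ m (+ w))) ⟩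
      Φ (m - + w) xor Φ (m - (+ 2 + + w))            ∎)
      where
      shift₁ : ∀ m w → m + (+ 2 + w) ≡ (m + (+ 1 + w)) + + 1
      shift₁ = solve-∀
      shift₂ : ∀ m w → m + w ≡ (m + (+ 1 + w)) - + 1
      shift₂ = solve-∀
      shift₃ : ∀ m w → (m - (+ 1 + w)) + + 1 ≡ m - w
      shift₃ = solve-∀
      shift₄ : ∀ m w → (m - (+ 1 + w)) - + 1 ≡ m - (+ 2 + w)
      shift₄ = solve-∀

open IntegerSymmetry

open import Data.Nat
open import Data.Nat.Properties
open import Data.Nat.DivMod
open import Data.Nat.Divisibility using (_∣_; divides; ∣⇒≤)
open import Data.Nat.GCD using (gcd; gcd[m,n]≢0; gcd[m,n]∣m; gcd[m,n]∣n; gcd-GCD; module GCD)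
open import Data.Nat.Tactic.RingSolver using (solve-∀)
open import Data.Integer as ℤ using (ℤ; +_; 0ℤ; ∣_∣; _⊖_)
import Data.Integer.Properties as ℤ
import Data.Integer.Tactic.RingSolver as ℤ-Solver
open import Data.Fin using (Fin; toℕ; fromℕ<) renaming (zero to fz; suc to fs)
import Data.Fin.Properties as Fin

%2-+2 : ∀ k → suc (suc k) % 2 ≡ k % 2
%2-+2 k = trans (cong (_% 2) (+-comm 2 k)) ([m+n]%n≡m%n k 2)

even-sum⇒%2≡ : ∀ a b → (a + b) % 2 ≡ 0 → a % 2 ≡ b % 2
even-sum⇒%2≡ zero b even = sym even
even-sum⇒%2≡ (suc zero) b even = sym (%-pred-≡0 {b} even)
even-sum⇒%2≡ (suc (suc a)) b even = trans (%2-+2 a) (even-sum⇒%2≡ a b (trans (sym (%2-+2 (a + b))) even))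

%2-suc : ∀ k → suc k % 2 ≡ 1 ∸ k % 2
%2-suc zero = refl
%2-suc (suc zero) = refl
%2-suc (suc (suc k)) = trans (%2-+2 (suc k)) (trans (%2-suc k) (cong (1 ∸_) (sym (%2-+2 k))))

%2-cases : ∀ {s} → s ≤ 1 → ∀ k → k % 2 ≡ s ⊎ k % 2 ≡ 1 ∸ s
%2-cases {s} s≤1 k with k % 2 | m%n<n k 2
%2-cases z≤n             k | zero    | _ = inj₁ refl
%2-cases (s≤s z≤n)       k | zero    | _ = inj₂ refl
%2-cases z≤n             k | suc zero | _ = inj₂ refl
%2-cases (s≤s z≤n)       k | suc zero | _ = inj₁ refl
%2-cases s≤1             k | suc (suc _) | s≤s (s≤s ())

1∸s≢s : ∀ {s} → s ≤ 1 → 1 ∸ s ≢ s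
1∸s≢s z≤n ()
1∸s≢s (s≤s z≤n) ()

1∸[1∸s]≡s : ∀ {s} → s ≤ 1 → 1 ∸ (1 ∸ s) ≡ s
1∸[1∸s]≡s z≤n = refl
1∸[1∸s]≡s (s≤s z≤n) = refl

%2-suc-+-suc : ∀ x y → (suc x + suc y) % 2 ≡ colour x y
%2-suc-+-suc x y = trans (cong (λ k → suc k % 2) (+-suc x y)) (%2-+2 (x + y))

parity-split : ∀ {s f} → f % 2 ≡ s → f ≡ s ⊎ ∃ λ i → f ≡ s + (2 + 2 * i)
parity-split {s} {f} f%2≡s with f / 2 | m≡m%n+[m/n]*n f 2
... | zero  | f≡ = inj₁ (trans f≡ (trans (+-identityʳ (f % 2)) f%2≡s))
... | suc i | f≡ = inj₂ (i , trans f≡ (cong₂ _+_ f%2≡s (twice i)))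
  where
  twice : ∀ i → suc i * 2 ≡ 2 + 2 * i
  twice = solve-∀

∣⊖∣-%2 : ∀ a b → ∣ a ⊖ b ∣ % 2 ≡ (a + b) % 2
∣⊖∣-%2 zero zero = refl
∣⊖∣-%2 zero (suc b) = refl
∣⊖∣-%2 (suc a) zero = cong (_% 2) (sym (+-identityʳ (suc a)))
∣⊖∣-%2 (suc a) (suc b) =
  trans (cong (λ z → ∣ z ∣ % 2) (ℤ.[1+m]⊖[1+n]≡m⊖n a b)) (trans (∣⊖∣-%2 a b) (sym (%2-suc-+-suc a b)))

triangle : ℕ → ℕ → ℕ
triangle q r with r ≤? suc q
... | yes _ = r
... | no _ = 2 * suc q ∸ r

-- fold q w is w folded onto [0, q + 1] by the reflections in 0 and q + 1.
fold : ℕ → ℕ → ℕ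
fold q w = triangle q (w % (2 * suc q))

2[1+q]≡[1+q]+[1+q] : ∀ q → 2 * suc q ≡ suc q + suc q
2[1+q]≡[1+q]+[1+q] q = cong (λ k → suc q + k) (+-identityʳ (suc q))

2[1+q]∸[1+q]≡1+q : ∀ q → 2 * suc q ∸ suc q ≡ suc q
2[1+q]∸[1+q]≡1+q q = trans (cong (_∸ suc q) (2[1+q]≡[1+q]+[1+q] q)) (m+n∸m≡n (suc q) (suc q))

triangle-≤ : ∀ q r → triangle q r ≤ suc q
triangle-≤ q r with r ≤? suc q
... | yes r≤ = r≤
... | no r≰ = ≤-trans (∸-monoʳ-≤ (2 * suc q) (<⇒≤ (≰⇒> r≰))) (≤-reflexive (2[1+q]∸[1+q]≡1+q q))

triangle-id : ∀ {q r} → r ≤ suc q → triangle q r ≡ r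
triangle-id {q} {r} r≤ with r ≤? suc q
... | yes _ = refl
... | no r≰ = contradiction r≤ r≰

triangle-reflect : ∀ {q r} → suc q ≤ r → triangle q r ≡ 2 * suc q ∸ r
triangle-reflect {q} {r} q<r with r ≤? suc q
... | yes r≤ rewrite ≤-antisym r≤ q<r = sym (2[1+q]∸[1+q]≡1+q q)
... | no _ = refl

fold-≤ : ∀ q w → fold q w ≤ suc q
fold-≤ q w = triangle-≤ q (w % (2 * suc q))

fold-id : ∀ {q w} → w ≤ suc q → fold q w ≡ w
fold-id {q} {w} w≤ = trans (cong (triangle q) (m<n⇒m%n≡m w<2[1+q])) (triangle-id w≤)
  where
  w<2[1+q] : w < 2 * suc q
  w<2[1+q] = ≤-<-trans w≤ (m<m+n (suc q) z<s)

fold-periodic : ∀ q w → fold q (w + 2 * suc q) ≡ fold q w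
fold-periodic q w = cong (triangle q) ([m+n]%n≡m%n w (2 * suc q))

triangle-%2 : ∀ q r → r ≤ 2 * suc q → triangle q r % 2 ≡ r % 2
triangle-%2 q r r≤ with r ≤? suc q
... | yes _ = refl
... | no _ = even-sum⇒%2≡ (2 * suc q ∸ r) r
  (trans (cong (_% 2) (m∸n+n≡m r≤)) (trans (cong (_% 2) (*-comm 2 (suc q))) (m*n%n≡0 (suc q) 2)))

fold-%2 : ∀ q w → fold q w % 2 ≡ w % 2
fold-%2 q w = trans (triangle-%2 q (w % (2 * suc q)) (m%n≤n w (2 * suc q)))
                    (m∣n⇒o%n%m≡o%m 2 (2 * suc q) w (divides (suc q) (*-comm 2 (suc q))))

fold-reflect : ∀ q {w} → w ≤ suc q → fold q (suc q + w) ≡ suc q ∸ w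
fold-reflect q {w} w≤ with m≤n⇒m<n∨m≡n w≤
... | inj₁ w<1+q = begin
  fold q (suc q + w)              ≡⟨ cong (triangle q) (m<n⇒m%n≡m 1+q+w<2[1+q]) ⟩
  triangle q (suc q + w)          ≡⟨ triangle-reflect (m≤m+n (suc q) w) ⟩
  2 * suc q ∸ (suc q + w)         ≡⟨ cong (_∸ (suc q + w)) (2[1+q]≡[1+q]+[1+q] q) ⟩
  (suc q + suc q) ∸ (suc q + w)   ≡⟨ [m+n]∸[m+o]≡n∸o (suc q) (suc q) w ⟩
  suc q ∸ w                       ∎
  where
  open ≡-Reasoning
  1+q+w<2[1+q] : suc q + w < 2 * suc q
  1+q+w<2[1+q] = subst (suc q + w <_) (sym (2[1+q]≡[1+q]+[1+q] q)) (+-monoʳ-< (suc q) w<1+q)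
... | inj₂ refl = begin
  fold q (suc q + suc q) ≡⟨ cong (fold q) (2[1+q]≡[1+q]+[1+q] q) ⟨
  fold q (0 + 2 * suc q) ≡⟨ fold-periodic q 0 ⟩
  fold q 0               ≡⟨ fold-id {q} z≤n ⟩
  0                      ≡⟨ n∸n≡0 (suc q) ⟨
  suc q ∸ suc q          ∎
  where open ≡-Reasoning

fold-symmetric : ∀ q → SymmetricAbout (λ z → fold q ∣ z ∣) (+ suc q)
fold-symmetric q = symmetricAbout-of-ℕ (λ w →
  trans (reflected w) (cong (λ z → fold q ∣ z ∣) (sym (ℤ.m-n≡m⊖n (suc q) w))))
  where
  reflected : ∀ w → fold q (suc q + w) ≡ fold q ∣ suc q ⊖ w ∣
  reflected w with w ≤? suc q
  ... | yes w≤ = trans (fold-reflect q w≤)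
    (sym (trans (cong (λ z → fold q ∣ z ∣) (ℤ.⊖-≥ w≤)) (fold-id (m∸n≤m (suc q) w))))
  ... | no w≰ = begin
    fold q (suc q + w)                       ≡⟨ cong (fold q) (+-comm (suc q) w) ⟩
    fold q (w + suc q)                       ≡⟨ cong (λ k → fold q (k + suc q)) (m∸n+n≡m 1+q≤w) ⟨
    fold q ((w ∸ suc q) + suc q + suc q)     ≡⟨ cong (fold q) (+-assoc (w ∸ suc q) (suc q) (suc q)) ⟩
    fold q ((w ∸ suc q) + (suc q + suc q))   ≡⟨ cong (λ k → fold q ((w ∸ suc q) + k)) (2[1+q]≡[1+q]+[1+q] q) ⟨
    fold q ((w ∸ suc q) + 2 * suc q)         ≡⟨ fold-periodic q (w ∸ suc q) ⟩
    fold q (w ∸ suc q)                       ≡⟨ cong (fold q) (ℤ.∣⊖∣-≰ w≰) ⟨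
    fold q ∣ suc q ⊖ w ∣                     ∎
    where
    open ≡-Reasoning
    1+q≤w : suc q ≤ w
    1+q≤w = <⇒≤ (≰⇒> w≰)

module _ {A : Set} {f : ℤ → A} {q : ℕ} (even : SymmetricAbout f 0ℤ) (symmetric : SymmetricAbout f (+ suc q)) where

  private
    periodic : ∀ r k → f (+ (r + k * (2 * suc q))) ≡ f (+ r)
    periodic r zero = cong (λ n → f (+ n)) (+-identityʳ r)
    periodic r (suc k) = begin
      f (+ (r + (2 * suc q + k * (2 * suc q))))              ≡⟨ cong (λ n → f (+ n)) (shuffle r k q) ⟩
      f (+ (r + k * (2 * suc q)) ℤ.+ (+ suc q ℤ.+ + suc q))  ≡⟨ symmetricAbout-periodic even symmetric _ ⟩
      f (+ (r + k * (2 * suc q)))                            ≡⟨ periodic r k ⟩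
      f (+ r)                                                ∎
      where
      open ≡-Reasoning
      shuffle : ∀ r k q → r + (2 * suc q + k * (2 * suc q)) ≡ (r + k * (2 * suc q)) + (suc q + suc q)
      shuffle = solve-∀

    reflected : ∀ {r} → r ≤ 2 * suc q → + (2 * suc q ∸ r) ≡ + suc q ℤ.+ (+ suc q ℤ.- + r)
    reflected {r} r≤ = begin
      + (2 * suc q ∸ r)                    ≡⟨ ℤ.⊖-≥ r≤ ⟨
      2 * suc q ⊖ r                        ≡⟨ ℤ.m-n≡m⊖n (2 * suc q) r ⟨
      + (2 * suc q) ℤ.- + r                ≡⟨ cong (λ n → + n ℤ.- + r) (2[1+q]≡[1+q]+[1+q] q) ⟩
      (+ suc q ℤ.+ + suc q) ℤ.- + r        ≡⟨ ℤ.+-assoc (+ suc q) (+ suc q) (ℤ.- + r) ⟩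
      + suc q ℤ.+ (+ suc q ℤ.- + r)        ∎
      where open ≡-Reasoning

    triangle-invariant : ∀ r → r ≤ 2 * suc q → f (+ r) ≡ f (+ triangle q r)
    triangle-invariant r r≤ with r ≤? suc q
    ... | yes _ = refl
    ... | no _ = sym (trans (cong f (reflected r≤)) (symmetricAbout-reflect symmetric (+ r)))

  fold-invariant : ∀ z → f z ≡ f (+ fold q ∣ z ∣)
  fold-invariant z = begin
    f z                                                ≡⟨ symmetricAbout-0⇒abs even z ⟩
    f (+ w)                                            ≡⟨ cong (λ n → f (+ n)) (m≡m%n+[m/n]*n w (2 * suc q)) ⟩
    f (+ (w % (2 * suc q) + (w / (2 * suc q)) * (2 * suc q)))  ≡⟨ periodic _ (w / (2 * suc q)) ⟩
    f (+ (w % (2 * suc q)))                            ≡⟨ triangle-invariant _ (m%n≤n w (2 * suc q)) ⟩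
    f (+ fold q w)                                     ∎
    where
    open ≡-Reasoning
    w : ℕ
    w = ∣ z ∣

neighbourSum : (ℕ → ℕ → Bool) → ℕ → ℕ → Bool
neighbourSum F x y = F x (suc y) xor (F (2 + x) (suc y) xor (F (suc x) y xor F (suc x) (2 + y)))

-- The four neighbours of (1 + x, 1 + y), over which neighbourSum F x y sums F.
data Neighbour (x y : ℕ) : ℕ → ℕ → Set where
  left  : Neighbour x y x (suc y)
  right : Neighbour x y (2 + x) (suc y)
  below : Neighbour x y (suc x) y
  above : Neighbour x y (suc x) (2 + y)

neighbourSum-cong : ∀ {F G} x y → (∀ {X Y} → Neighbour x y X Y → F X Y ≡ G X Y) →
  neighbourSum F x y ≡ neighbourSum G x y
neighbourSum-cong x y eq = cong₂ _xor_ (eq left) (cong₂ _xor_ (eq right) (cong₂ _xor_ (eq below) (eq above)))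

neighbour-box : ∀ {x y X Y} → Neighbour x y X Y → (x ≤ X × X ≤ 2 + x) × (y ≤ Y × Y ≤ 2 + y)
neighbour-box {x} {y} left  = (≤-refl , m≤n+m x 2) , (n≤1+n y , m≤n+m (suc y) 1)
neighbour-box {x} {y} right = (m≤n+m x 2 , ≤-refl) , (n≤1+n y , m≤n+m (suc y) 1)
neighbour-box {x} {y} below = (n≤1+n x , m≤n+m (suc x) 1) , (≤-refl , m≤n+m y 2)
neighbour-box {x} {y} above = (n≤1+n x , m≤n+m (suc x) 1) , (m≤n+m y 2 , ≤-refl)

neighbour-%2 : ∀ {x y X Y} → Neighbour x y X Y → (X + Y) % 2 ≡ 1 ∸ (x + y) % 2
neighbour-%2 {x} {y} nb = trans (shifted nb) (%2-suc (x + y))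
  where
  shifted : ∀ {X Y} → Neighbour x y X Y → (X + Y) % 2 ≡ suc (x + y) % 2
  shifted left  = cong (_% 2) (+-suc x y)
  shifted right = trans (cong (λ k → suc (suc k) % 2) (+-suc x y)) (%2-+2 (suc (x + y)))
  shifted below = refl
  shifted above = trans (cong (λ k → suc k % 2) (trans (+-suc x (suc y)) (cong suc (+-suc x y)))) (%2-+2 (suc (x + y)))

-- pad v is v shifted by (1, 1): the p × q graph becomes [1, p] × [1, q], and the lines
-- X = 0, X = p + 1, Y = 0, Y = q + 1 around it carry the padding zeros.
pad : (ℕ → ℕ → Bool) → ℕ → ℕ → Bool
pad v zero    y       = false
pad v (suc x) zero    = false
pad v (suc x) (suc y) = v x y

pad-cong : ∀ {v w} → (∀ x y → v x y ≡ w x y) → ∀ X Y → pad v X Y ≡ pad w X Y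
pad-cong eq zero    Y       = refl
pad-cong eq (suc X) zero    = refl
pad-cong eq (suc X) (suc Y) = eq X Y

masked : ℕ → ℕ → ℕ → ℕ → Fn → Fn
masked a b p q v x y = inR a b p q x y ∧ v x y

nbSum≡neighbourSum : ∀ a b p q v x y → nbSum a b p q v x y ≡ neighbourSum (pad (masked a b p q v)) x y
nbSum≡neighbourSum a b p q v zero    zero    = refl
nbSum≡neighbourSum a b p q v zero    (suc y) = refl
nbSum≡neighbourSum a b p q v (suc x) zero    = refl
nbSum≡neighbourSum a b p q v (suc x) (suc y) = refl

neighbourSum-above : ∀ {F G x y} → neighbourSum F x y ≡ false → neighbourSum G x y ≡ false →
  F x (suc y) ≡ G x (suc y) → F (2 + x) (suc y) ≡ G (2 + x) (suc y) → F (suc x) y ≡ G (suc x) y →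
  F (suc x) (2 + y) ≡ G (suc x) (2 + y)
neighbourSum-above {F} {G} {x} {y} harmonicF harmonicG left≡ right≡ below≡ =
  xor-cancelˡ (G (suc x) y) (xor-cancelˡ (G (2 + x) (suc y)) (xor-cancelˡ (G x (suc y))
    (trans (sym (cong₂ _xor_ left≡ (cong₂ _xor_ right≡ (cong (_xor F (suc x) (2 + y)) below≡))))
           (trans harmonicF (sym harmonicG)))))

module _ {m n : ℕ} {F G : ℕ → ℕ → Bool}
  (harmonicF : ∀ x y → x < m → y < n → neighbourSum F x y ≡ false)
  (harmonicG : ∀ x y → x < m → y < n → neighbourSum G x y ≡ false)
  (left-edge : ∀ Y → F 0 Y ≡ G 0 Y) (right-edge : ∀ Y → F (suc m) Y ≡ G (suc m) Y)
  (row₀ : ∀ X → X ≤ suc m → F X 0 ≡ G X 0) (row₁ : ∀ X → X ≤ suc m → F X 1 ≡ G X 1) where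

  private
    RowAgrees : ℕ → Set
    RowAgrees Y = ∀ X → X ≤ suc m → F X Y ≡ G X Y

    next-row : ∀ Y → Y < n → RowAgrees Y → RowAgrees (suc Y) → RowAgrees (2 + Y)
    next-row Y Y<n rowY rowY+1 zero _ = left-edge (2 + Y)
    next-row Y Y<n rowY rowY+1 (suc x) x≤m with m≤n⇒m<n∨m≡n (≤-pred x≤m)
    ... | inj₁ x<m = neighbourSum-above {F} {G} (harmonicF x Y x<m Y<n) (harmonicG x Y x<m Y<n)
                       (rowY+1 x (m≤n⇒m≤1+n (<⇒≤ x<m))) (rowY+1 (2 + x) (s≤s x<m)) (rowY (suc x) x≤m)
    ... | inj₂ refl = right-edge (2 + Y)

    consecutive-rows : ∀ Y → Y ≤ n → RowAgrees Y × RowAgrees (suc Y)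
    consecutive-rows zero _ = row₀ , row₁
    consecutive-rows (suc Y) Y<n with consecutive-rows Y (<⇒≤ Y<n)
    ... | rowY , rowY+1 = rowY+1 , next-row Y Y<n rowY rowY+1

  strip-uniqueness : ∀ X Y → X ≤ suc m → Y ≤ suc n → F X Y ≡ G X Y
  strip-uniqueness X zero X≤ _ = row₀ X X≤
  strip-uniqueness X (suc Y) X≤ Y<1+n = proj₂ (consecutive-rows Y (≤-pred Y<1+n)) X X≤

<ᵇ≡true⇔< : ∀ {m n} → (m <ᵇ n) ≡ true ⇔ m < n
<ᵇ≡true⇔< {m} {n} =
  mk⇔ (λ eq → <ᵇ⇒< m n (Equivalence.from T-≡ eq)) (λ m<n → Equivalence.to T-≡ (<⇒<ᵇ m<n))

≤ᵇ≡true⇔≤ : ∀ {m n} → (m ≤ᵇ n) ≡ true ⇔ m ≤ n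
≤ᵇ≡true⇔≤ {m} {n} =
  mk⇔ (λ eq → ≤ᵇ⇒≤ m n (Equivalence.from T-≡ eq)) (λ m≤n → Equivalence.to T-≡ (≤⇒≤ᵇ m≤n))

≡ᵇ≡true⇔≡ : ∀ {m n} → (m ≡ᵇ n) ≡ true ⇔ m ≡ n
≡ᵇ≡true⇔≡ {m} {n} =
  mk⇔ (λ eq → ≡ᵇ⇒≡ m n (Equivalence.from T-≡ eq)) (λ m≡n → Equivalence.to T-≡ (≡⇒≡ᵇ m n m≡n))

inR-bounds : ∀ {a b p q x y} → inR a b p q x y ≡ true → (a ≤ x × x < a + p) × (b ≤ y × y < b + q)
inR-bounds h with ∧≡true h
... | a≤x , rest with ∧≡true rest
... | x< , rest′ with ∧≡true rest′
... | b≤y , y< = (Equivalence.to ≤ᵇ≡true⇔≤ a≤x , Equivalence.to <ᵇ≡true⇔< x<)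
               , (Equivalence.to ≤ᵇ≡true⇔≤ b≤y , Equivalence.to <ᵇ≡true⇔< y<)

inR-intro : ∀ {a b p q x y} → a ≤ x → x < a + p → b ≤ y → y < b + q → inR a b p q x y ≡ true
inR-intro a≤x x< b≤y y<
  rewrite Equivalence.from ≤ᵇ≡true⇔≤ a≤x | Equivalence.from <ᵇ≡true⇔< x<
        | Equivalence.from ≤ᵇ≡true⇔≤ b≤y | Equivalence.from <ᵇ≡true⇔< y< = refl

inR-origin-bounds : ∀ {p q x y} → inR 0 0 p q x y ≡ true → x < p × y < q
inR-origin-bounds {p} {q} {x} {y} h with inR-bounds {0} {0} {p} {q} {x} {y} h
... | (_ , x<p) , (_ , y<q) = x<p , y<q

inR-origin-intro : ∀ {p q x y} → x < p → y < q → inR 0 0 p q x y ≡ true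
inR-origin-intro {p} {q} x<p y<q = inR-intro {0} {0} {p} {q} z≤n x<p z≤n y<q

SupportedIn : ℕ → ℕ → Fn → Set
SupportedIn p q v = ∀ x y → v x y ≡ true → inR 0 0 p q x y ≡ true

-- v lies in the kernel of the adjacency map of the whole p × q graph, which mod 2 is its Laplacian.
Harmonic : ℕ → ℕ → Fn → Set
Harmonic p q v = SupportedIn p q v × (∀ x y → x < p → y < q → neighbourSum (pad v) x y ≡ false)

-- Ker 0 is KerBW and Ker 1 is KerWB.
Ker : ℕ → ℕ → ℕ → Fn → Set
Ker s p q v = Supported s p q v × KerCond (1 ∸ s) 0 0 p q v

colourPart : ℕ → Fn → Fn
colourPart s v x y = (colour x y ≡ᵇ s) ∧ v x y

restrict : ℕ → ℕ → (ℕ → ℕ → Bool) → Fn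
restrict p q G x y = inR 0 0 p q x y ∧ G (suc x) (suc y)

supportedIn-vanishes : ∀ {p q v} → SupportedIn p q v → ∀ {x y} → ¬ (inR 0 0 p q x y ≡ true) → v x y ≡ false
supportedIn-vanishes {v = v} supported {x} {y} outside with v x y in eq
... | true = contradiction (supported x y eq) outside
... | false = refl

masked-supported : ∀ {p q v} → SupportedIn p q v → ∀ x y → masked 0 0 p q v x y ≡ v x y
masked-supported {v = v} supported x y with v x y in eq
... | true = cong (_∧ true) (supported x y eq)
... | false = ∧-zeroʳ _

nbSum-supported : ∀ {p q v} → SupportedIn p q v → ∀ x y → nbSum 0 0 p q v x y ≡ neighbourSum (pad v) x y
nbSum-supported {p} {q} {v} supported x y = trans (nbSum≡neighbourSum 0 0 p q v x y)
  (neighbourSum-cong x y (λ {X} {Y} _ → pad-cong (masked-supported {p} {q} {v} supported) X Y))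

pad-off-colour : ∀ {p q v s} → Supported s p q v → ∀ X Y → (X + Y) % 2 ≢ s → pad v X Y ≡ false
pad-off-colour supported zero    Y       _ = refl
pad-off-colour supported (suc X) zero    _ = refl
pad-off-colour {v = v} supported (suc X) (suc Y) off with v X Y in eq
... | true = contradiction (trans (%2-suc-+-suc X Y) (proj₂ (supported X Y eq))) off
... | false = refl

ker⇒harmonic : ∀ {p q v s} → s ≤ 1 → Ker s p q v → Harmonic p q v
ker⇒harmonic {p} {q} {v} {s} s≤1 (supported , ker) = supportedIn , harmonic
  where
  supportedIn : SupportedIn p q v
  supportedIn x y h = proj₁ (supported x y h)
  harmonic : ∀ x y → x < p → y < q → neighbourSum (pad v) x y ≡ false
  harmonic x y x<p y<q with %2-cases s≤1 (x + y)
  ... | inj₂ other =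
    trans (sym (nbSum-supported {p} {q} supportedIn x y)) (ker x y (inR-origin-intro {p} {q} x<p y<q) other)
  -- Every neighbour of a point of colour s has the other colour, where v vanishes.
  ... | inj₁ same = neighbourSum-cong {G = λ _ _ → false} x y λ {X} {Y} nb →
    pad-off-colour {p} {q} supported X Y λ eq →
      1∸s≢s s≤1 (trans (sym (trans (neighbour-%2 nb) (cong (1 ∸_) same))) eq)

colourPart-ker : ∀ {p q v s} → Ker s p q v → ∀ x y → colourPart s v x y ≡ v x y
colourPart-ker (supported , _) x y = ∧-redundantˡ (λ eq → Equivalence.from ≡ᵇ≡true⇔≡ (proj₂ (supported x y eq)))

pad-colourPart : ∀ {v s} X Y → (X + Y) % 2 ≡ s → pad (colourPart s v) X Y ≡ pad v X Y
pad-colourPart zero    Y       _ = refl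
pad-colourPart (suc X) zero    _ = refl
pad-colourPart {v = v} (suc X) (suc Y) eq =
  cong (_∧ v X Y) (Equivalence.from ≡ᵇ≡true⇔≡ (trans (sym (%2-suc-+-suc X Y)) eq))

harmonic⇒ker-colourPart : ∀ {p q v s} → s ≤ 1 → Harmonic p q v → Ker s p q (colourPart s v)
harmonic⇒ker-colourPart {p} {q} {v} {s} s≤1 (supportedIn , harmonic) = supported , ker
  where
  supported : Supported s p q (colourPart s v)
  supported x y h with ∧≡true h
  ... | colour≡s , v≡true = supportedIn x y v≡true , Equivalence.to ≡ᵇ≡true⇔≡ colour≡s
  ker : KerCond (1 ∸ s) 0 0 p q (colourPart s v)
  ker x y inside other with inR-origin-bounds {p} {q} inside
  ... | x<p , y<q = begin
    nbSum 0 0 p q (colourPart s v) x y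
      ≡⟨ nbSum-supported {p} {q} {colourPart s v} (λ x y h → proj₁ (supported x y h)) x y ⟩
    neighbourSum (pad (colourPart s v)) x y     ≡⟨ neighbourSum-cong x y (λ {X} {Y} nb → pad-colourPart {v} X Y
                                                     (trans (neighbour-%2 nb) (trans (cong (1 ∸_) other) (1∸[1∸s]≡s s≤1)))) ⟩
    neighbourSum (pad v) x y                    ≡⟨ harmonic x y x<p y<q ⟩
    false                                       ∎
    where open ≡-Reasoning

module _ {p q : ℕ} {G : ℕ → ℕ → Bool}
  (left-edge : ∀ Y → G 0 Y ≡ false) (bottom-edge : ∀ X → G X 0 ≡ false)
  (right-edge : ∀ Y → G (suc p) Y ≡ false) (top-edge : ∀ X → G X (suc q) ≡ false) where

  pad-restrict : ∀ X Y → X ≤ suc p → Y ≤ suc q → pad (restrict p q G) X Y ≡ G X Y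
  pad-restrict zero    Y       _ _ = sym (left-edge Y)
  pad-restrict (suc X) zero    _ _ = sym (bottom-edge (suc X))
  pad-restrict (suc X) (suc Y) X<1+p Y<1+q = ∧-redundantˡ λ G≡true → inR-origin-intro {p} {q}
    (≤∧≢⇒< (≤-pred X<1+p) λ { refl → contradiction (trans (sym G≡true) (right-edge (suc Y))) λ () })
    (≤∧≢⇒< (≤-pred Y<1+q) λ { refl → contradiction (trans (sym G≡true) (top-edge (suc X))) λ () })

  restrict-harmonic : (∀ x y → x < p → y < q → neighbourSum G x y ≡ false) → Harmonic p q (restrict p q G)
  restrict-harmonic harmonic = supported , λ x y x<p y<q →
    trans (neighbourSum-cong x y (λ {X} {Y} nb → pad-restrict X Y
            (≤-trans (proj₂ (proj₁ (neighbour-box nb))) (s≤s x<p))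
            (≤-trans (proj₂ (proj₂ (neighbour-box nb))) (s≤s y<q))))
          (harmonic x y x<p y<q)
    where
    supported : SupportedIn p q (restrict p q G)
    supported x y h = proj₁ (∧≡true h)

-- Kernel elements are d'Alembert functions

dAlembertGrid : (ℤ → Bool) → ℕ → ℕ → Bool
dAlembertGrid Φ X Y = dAlembert Φ (+ X) (+ Y)

dAlembertGrid-harmonic : ∀ Φ x y → neighbourSum (dAlembertGrid Φ) x y ≡ false
dAlembertGrid-harmonic Φ x y = trans (sym (xor-assoc (G x (suc y)) (G (2 + x) (suc y)) (G (suc x) y xor G (suc x) (2 + y))))
  (≡⇒xor≡false (dAlembert-horizontal≡vertical Φ (+ x) (+ y)))
  where
  G : ℕ → ℕ → Bool
  G = dAlembertGrid Φ

dAlembertGrid-column : ∀ {Φ K} → SymmetricAbout Φ (+ K) → ∀ Y → dAlembertGrid Φ K Y ≡ false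
dAlembertGrid-column symmetric Y = ≡⇒xor≡false (mirror symmetric (+ Y))

dAlembertGrid-row : ∀ {Φ K} → SymmetricAbout Φ 0ℤ → SymmetricAbout Φ (+ K) → ∀ X → dAlembertGrid Φ X K ≡ false
dAlembertGrid-row {Φ} {K} even symmetric X =
  trans (dAlembert-transpose Φ even (+ X) (+ K)) (dAlembertGrid-column symmetric X)

restrict-dAlembert-harmonic : ∀ {Φ m n} → SymmetricAbout Φ 0ℤ → SymmetricAbout Φ (+ suc m) → SymmetricAbout Φ (+ suc n) →
  Harmonic m n (restrict m n (dAlembertGrid Φ))
restrict-dAlembert-harmonic {Φ} {m} {n} even symmetric-m symmetric-n =
  restrict-harmonic {m} {n} {dAlembertGrid Φ} (dAlembertGrid-column even) (dAlembertGrid-row even even)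
    (dAlembertGrid-column symmetric-m) (dAlembertGrid-row even symmetric-n) (λ x y _ _ → dAlembertGrid-harmonic Φ x y)

record DAlembertForm (m n : ℕ) (v : Fn) : Set where
  field
    Φ : ℤ → Bool
    even : SymmetricAbout Φ 0ℤ
    symmetric-m : SymmetricAbout Φ (+ suc m)
    symmetric-n : SymmetricAbout Φ (+ suc n)
    pad≡dAlembert : ∀ X Y → X ≤ suc m → Y ≤ suc n → pad v X Y ≡ dAlembertGrid Φ X Y

module _ {m n : ℕ} {v : Fn} (harmonic : Harmonic m n v) where

  private
    right-edge : ∀ Y → pad v (suc m) Y ≡ false
    right-edge zero = refl
    right-edge (suc y) = supportedIn-vanishes {m} {n} (proj₁ harmonic) (λ h → <-irrefl refl (proj₁ (inR-origin-bounds {m} {n} h)))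

    top-edge : ∀ X → pad v X (suc n) ≡ false
    top-edge zero = refl
    top-edge (suc x) = supportedIn-vanishes {m} {n} (proj₁ harmonic) (λ h → <-irrefl refl (proj₂ (inR-origin-bounds {m} {n} h)))

    -- Row 1 of pad v, extended to ℕ by the reflections in 0 and m + 1.
    ρ : ℕ → Bool
    ρ w = pad v (fold m w) 1

    Φ : ℤ → Bool
    Φ = evenExtension (integrate ρ)

    even : SymmetricAbout Φ 0ℤ
    even = evenExtension-even (integrate ρ)

    row : ∀ x → dAlembert Φ x (+ 1) ≡ ρ ∣ x ∣
    row = dAlembert-integrate-row (cong (λ k → pad v k 1) (fold-id {m} z≤n))

    symmetric-m : SymmetricAbout Φ (+ suc m)
    symmetric-m = symmetricAbout-from-row
      (mirrored λ z → trans (row (+ suc m ℤ.+ z))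
        (trans (cong (λ k → pad v k 1) (mirror (fold-symmetric m) z)) (sym (row (+ suc m ℤ.- z)))))
      (trans (row (+ suc m)) (trans (cong (λ k → pad v k 1) (fold-id {m} ≤-refl)) (right-edge 1)))

    pad≡dAlembert : ∀ X Y → X ≤ suc m → Y ≤ suc n → pad v X Y ≡ dAlembertGrid Φ X Y
    pad≡dAlembert = strip-uniqueness {m} {n} {pad v} {dAlembertGrid Φ} (proj₂ harmonic) (λ x y _ _ → dAlembertGrid-harmonic Φ x y)
      (λ Y → sym (dAlembertGrid-column even Y))
      (λ Y → trans (right-edge Y) (sym (dAlembertGrid-column symmetric-m Y)))
      (λ X _ → trans (pad-row₀ X) (sym (dAlembertGrid-row even even X)))
      (λ X X≤ → trans (cong (λ k → pad v k 1) (sym (fold-id X≤))) (sym (row (+ X))))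
      where
      pad-row₀ : ∀ X → pad v X 0 ≡ false
      pad-row₀ zero = refl
      pad-row₀ (suc X) = refl

    -- The column x ↦ dAlembert Φ x (n + 1) is the zero padding on [0, m + 1], and it is symmetric
    -- about 0 and m + 1.
    symmetric-n : SymmetricAbout Φ (+ suc n)
    symmetric-n = mirrored λ z → xor≡false⇒≡ (trans (dAlembert-transpose Φ even (+ suc n) z) (column-vanishes z))
      where
      column : ℤ → Bool
      column x = dAlembert Φ x (+ suc n)
      column-vanishes : ∀ x → column x ≡ false
      column-vanishes x = begin
        column x                      ≡⟨ fold-invariant {f = column} {q = m} (dAlembert-symmetricˣ Φ even (+ suc n))
                                                                               (dAlembert-symmetricˣ Φ symmetric-m (+ suc n)) x ⟩
        column (+ fold m ∣ x ∣)       ≡⟨ pad≡dAlembert (fold m ∣ x ∣) (suc n) (fold-≤ m ∣ x ∣) ≤-refl ⟨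
        pad v (fold m ∣ x ∣) (suc n)  ≡⟨ top-edge (fold m ∣ x ∣) ⟩
        false                         ∎
        where open ≡-Reasoning

  harmonic⇒dAlembertForm : DAlembertForm m n v
  harmonic⇒dAlembertForm = record
    { Φ = Φ ; even = even ; symmetric-m = symmetric-m ; symmetric-n = symmetric-n ; pad≡dAlembert = pad≡dAlembert }

-- The grid and the fundamental squares

kerCond-subrectangle : ∀ {m n v a b p q} t → Harmonic m n v → a + p ≤ m → b + q ≤ n →
  (∀ x y → v x y ≡ true → a ≤ suc x → x ≤ a + p → b ≤ suc y → y ≤ b + q → inR a b p q x y ≡ true) →
  KerCond t a b p q v
kerCond-subrectangle {m} {n} {v} {a} {b} {p} {q} t (_ , harmonic) a+p≤m b+q≤n frame x y inside _
  with inR-bounds {a} {b} {p} {q} inside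
... | (a≤x , x<) , (b≤y , y<) = begin
  nbSum a b p q v x y                       ≡⟨ nbSum≡neighbourSum a b p q v x y ⟩
  neighbourSum (pad (masked a b p q v)) x y ≡⟨ neighbourSum-cong x y (λ nb → pad-masked _ _ (neighbour-box nb)) ⟩
  neighbourSum (pad v) x y                  ≡⟨ harmonic x y (<-≤-trans x< a+p≤m) (<-≤-trans y< b+q≤n) ⟩
  false                                     ∎
  where
  open ≡-Reasoning
  pad-masked : ∀ X Y → (x ≤ X × X ≤ 2 + x) × (y ≤ Y × Y ≤ 2 + y) → pad (masked a b p q v) X Y ≡ pad v X Y
  pad-masked zero    Y       _ = refl
  pad-masked (suc X) zero    _ = refl
  pad-masked (suc X) (suc Y) ((x≤ , ≤x) , (y≤ , ≤y)) = ∧-redundantˡ λ v≡true →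
    frame X Y v≡true (≤-trans a≤x x≤) (≤-trans (≤-pred ≤x) x<) (≤-trans b≤y y≤) (≤-trans (≤-pred ≤y) y<)

suc[cOf]≡gcd : ∀ m n → suc (cOf m n) ≡ gcd (suc m) (suc n)
suc[cOf]≡gcd m n with gcd (suc m) (suc n) | gcd[m,n]≢0 (suc m) (suc n) (inj₁ (λ ()))
... | zero  | gcd≢0 = contradiction refl gcd≢0
... | suc g | _     = refl

reflection-ℤ : ∀ {K x} → x ≤ 2 * K → + suc (2 * K ∸ x) ≡ + suc K ℤ.+ (+ suc K ℤ.- + suc x)
reflection-ℤ {K} {x} x≤ = begin
  + 1 ℤ.+ + (2 * K ∸ x)             ≡⟨ cong (λ k → + 1 ℤ.+ k) (ℤ.⊖-≥ x≤) ⟨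
  + 1 ℤ.+ (2 * K ⊖ x)               ≡⟨ cong (λ k → + 1 ℤ.+ k) (ℤ.m-n≡m⊖n (2 * K) x) ⟨
  + 1 ℤ.+ (+ (2 * K) ℤ.- + x)       ≡⟨ cong (λ k → + 1 ℤ.+ (k ℤ.- + x)) (ℤ.pos-* 2 K) ⟩
  + 1 ℤ.+ (+ 2 ℤ.* + K ℤ.- + x)     ≡⟨ rearrange (+ K) (+ x) ⟩
  (+ 1 ℤ.+ + K) ℤ.+ ((+ 1 ℤ.+ + K) ℤ.- (+ 1 ℤ.+ + x)) ∎
  where
  open ≡-Reasoning
  rearrange : ∀ K x → + 1 ℤ.+ (+ 2 ℤ.* K ℤ.- x) ≡ (+ 1 ℤ.+ K) ℤ.+ ((+ 1 ℤ.+ K) ℤ.- (+ 1 ℤ.+ x))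
  rearrange = ℤ-Solver.solve-∀

mirror-bounds : ∀ {a c x M} → a ≤ x → x < a + c → suc (c + a) + c ≤ M →
  x < M × x ≤ 2 * (c + a) × 2 * (c + a) ∸ x < M
mirror-bounds {a} {c} {x} {M} a≤x x<a+c bound = x<M , x≤2[c+a] , <-≤-trans (s≤s mirror≤) bound
  where
  x≤c+a : x ≤ c + a
  x≤c+a = ≤-trans (<⇒≤ x<a+c) (≤-reflexive (+-comm a c))
  x<M : x < M
  x<M = <-≤-trans (s≤s x≤c+a) (≤-trans (m≤m+n (suc (c + a)) c) bound)
  x≤2[c+a] : x ≤ 2 * (c + a)
  x≤2[c+a] = ≤-trans x≤c+a (m≤m+n (c + a) (c + a + 0))
  mirror≤ : 2 * (c + a) ∸ x ≤ c + a + c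
  mirror≤ = ≤-trans (∸-monoʳ-≤ (2 * (c + a)) a≤x)
    (≤-reflexive (trans (cong (_∸ a) (twice c a)) (m+n∸n≡m (c + a + c) a)))
    where
    twice : ∀ c a → 2 * (c + a) ≡ (c + a + c) + a
    twice = solve-∀

near-square : ∀ {a c x} → a ≤ suc x → x ≤ a + c → suc x ≢ a → x ≢ a + c → a ≤ x × x < a + c
near-square a≤1+x x≤a+c 1+x≢a x≢a+c =
  ≤-pred (≤∧≢⇒< a≤1+x (λ eq → 1+x≢a (sym eq))) , ≤∧≢⇒< x≤a+c x≢a+c

module _ {m n : ℕ} {v : Fn} (harmonic : Harmonic m n v) where

  open DAlembertForm (harmonic⇒dAlembertForm harmonic)

  private
    c : ℕ
    c = cOf m n

  symmetric-c : SymmetricAbout Φ (+ suc c)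
  symmetric-c = subst (λ g → SymmetricAbout Φ (+ g)) (sym (suc[cOf]≡gcd m n))
    (symmetricAbout-gcd even symmetric-m symmetric-n)

  symmetric-grid : ∀ k → SymmetricAbout Φ (+ (k * suc c))
  symmetric-grid k = subst (SymmetricAbout Φ) (sym (ℤ.pos-* k (suc c))) (symmetricAbout-multiple even k symmetric-c)

  v≡dAlembert : ∀ {x y} → x < m → y < n → v x y ≡ dAlembertGrid Φ (suc x) (suc y)
  v≡dAlembert x<m y<n = pad≡dAlembert _ _ (s≤s (<⇒≤ x<m)) (s≤s (<⇒≤ y<n))

  v≡restrict : ∀ x y → v x y ≡ restrict m n (dAlembertGrid Φ) x y
  v≡restrict x y with inR 0 0 m n x y in inside
  ... | true = v≡dAlembert (proj₁ (inR-origin-bounds {m} {n} inside)) (proj₂ (inR-origin-bounds {m} {n} inside))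
  ... | false = supportedIn-vanishes {m} {n} (proj₁ harmonic) (λ h → contradiction (trans (sym inside) h) (λ ()))

  vanishes-on-grid : ∀ x y → inR 0 0 m n x y ≡ true → InGrid c x y → v x y ≡ false
  vanishes-on-grid x y inside on-grid with inR-origin-bounds {m} {n} inside | on-grid
  ... | x<m , y<n | inj₁ (k , 1+x≡) = trans (v≡dAlembert x<m y<n)
    (trans (cong (λ X → dAlembertGrid Φ X (suc y)) 1+x≡) (dAlembertGrid-column (symmetric-grid k) (suc y)))
  ... | x<m , y<n | inj₂ (l , 1+y≡) = trans (v≡dAlembert x<m y<n)
    (trans (cong (dAlembertGrid Φ (suc x)) 1+y≡) (dAlembertGrid-row even (symmetric-grid l) (suc x)))

  off-grid : ∀ {x y} → v x y ≡ true → ¬ InGrid c x y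
  off-grid {x} {y} v≡true on-grid =
    contradiction (trans (sym v≡true) (vanishes-on-grid x y (proj₁ harmonic x y v≡true) on-grid)) λ ()

  square-kernel : ∀ t k l → k * suc c + c ≤ m → l * suc c + c ≤ n → KerCond t (k * suc c) (l * suc c) c c v
  square-kernel t k l k-fits l-fits = kerCond-subrectangle t harmonic k-fits l-fits frame
    where
    next-line : ∀ k → suc (k * suc c + c) ≡ suc k * suc c
    next-line k = cong suc (+-comm (k * suc c) c)
    frame : ∀ x y → v x y ≡ true → k * suc c ≤ suc x → x ≤ k * suc c + c → l * suc c ≤ suc y → y ≤ l * suc c + c →
      inR (k * suc c) (l * suc c) c c x y ≡ true
    frame x y v≡true kC≤ ≤kC+c lC≤ ≤lC+c =
      inR-intro (proj₁ x-bounds) (proj₂ x-bounds) (proj₁ y-bounds) (proj₂ y-bounds)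
      where
      x-bounds : k * suc c ≤ x × x < k * suc c + c
      x-bounds = near-square kC≤ ≤kC+c (λ eq → off-grid v≡true (inj₁ (k , eq)))
                                      (λ eq → off-grid v≡true (inj₁ (suc k , trans (cong suc eq) (next-line k))))
      y-bounds : l * suc c ≤ y × y < l * suc c + c
      y-bounds = near-square lC≤ ≤lC+c (λ eq → off-grid v≡true (inj₂ (l , eq)))
                                      (λ eq → off-grid v≡true (inj₂ (suc l , trans (cong suc eq) (next-line l))))

  column-reflect : ∀ K {x y} → SymmetricAbout Φ (+ suc K) → x ≤ 2 * K → x < m → 2 * K ∸ x < m → y < n →
    v x y ≡ v (2 * K ∸ x) y
  column-reflect K {x} {y} symmetric x≤ x<m x′<m y<n = begin
    v x y                                                              ≡⟨ v≡dAlembert x<m y<n ⟩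
    dAlembert Φ (+ suc x) (+ suc y)
      ≡⟨ symmetricAbout-reflect (dAlembert-symmetricˣ Φ symmetric (+ suc y)) (+ suc x) ⟨
    dAlembert Φ (+ suc K ℤ.+ (+ suc K ℤ.- + suc x)) (+ suc y)    ≡⟨ cong (λ X → dAlembert Φ X (+ suc y)) (reflection-ℤ x≤) ⟨
    dAlembert Φ (+ suc (2 * K ∸ x)) (+ suc y)                    ≡⟨ v≡dAlembert x′<m y<n ⟨
    v (2 * K ∸ x) y                                                    ∎
    where open ≡-Reasoning

  row-reflect : ∀ K {x y} → SymmetricAbout Φ (+ suc K) → y ≤ 2 * K → y < n → 2 * K ∸ y < n → x < m →
    v x y ≡ v x (2 * K ∸ y)
  row-reflect K {x} {y} symmetric y≤ y<n y′<n x<m = begin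
    v x y                                                              ≡⟨ v≡dAlembert x<m y<n ⟩
    dAlembert Φ (+ suc x) (+ suc y)
      ≡⟨ symmetricAbout-reflect (dAlembert-symmetricʸ Φ even symmetric (+ suc x)) (+ suc y) ⟨
    dAlembert Φ (+ suc x) (+ suc K ℤ.+ (+ suc K ℤ.- + suc y))    ≡⟨ cong (dAlembert Φ (+ suc x)) (reflection-ℤ y≤) ⟨
    dAlembert Φ (+ suc x) (+ suc (2 * K ∸ y))                    ≡⟨ v≡dAlembert x<m y′<n ⟨
    v x (2 * K ∸ y)                                                    ∎
    where open ≡-Reasoning

  props : ∀ t → Props t m n c v
  props t = vanishes-on-grid , square-kernel t , columns , rows
    where
    columns : ∀ k l → suc k * suc c + c ≤ m → l * suc c + c ≤ n → ∀ x y →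
      inR (k * suc c) (l * suc c) c c x y ≡ true → v x y ≡ v (2 * (suc k * suc c ∸ 1) ∸ x) y
    columns k l k-fits l-fits x y inside with inR-bounds {k * suc c} {l * suc c} {c} {c} inside
    ... | (kC≤x , x<) , (_ , y<) with mirror-bounds kC≤x x< k-fits
    ...   | x<m , x≤ , x′<m = column-reflect (c + k * suc c) (symmetric-grid (suc k)) x≤ x<m x′<m (<-≤-trans y< l-fits)
    rows : ∀ k l → k * suc c + c ≤ m → suc l * suc c + c ≤ n → ∀ x y →
      inR (k * suc c) (l * suc c) c c x y ≡ true → v x y ≡ v x (2 * (suc l * suc c ∸ 1) ∸ y)
    rows k l k-fits l-fits x y inside with inR-bounds {k * suc c} {l * suc c} {c} {c} inside
    ... | (_ , x<) , (lC≤y , y<) with mirror-bounds lC≤y y< l-fits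
    ...   | y<n , y≤ , y′<n = row-reflect (c + l * suc c) (symmetric-grid (suc l)) y≤ y<n y′<n (<-≤-trans x< k-fits)

-- The dimension of the kernels

comb-zero : ∀ {k} (γ : Fin k → Bool) {B : Fin k → Fn} {x y} → (∀ i → B i x y ≡ false) → comb γ B x y ≡ false
comb-zero {zero} γ eq = refl
comb-zero {suc k} γ eq = cong₂ _xor_ (trans (cong (γ fz ∧_) (eq fz)) (∧-zeroʳ (γ fz))) (comb-zero (γ ∘ fs) (eq ∘ fs))

comb-delta : ∀ {k} (γ : Fin k → Bool) {B : Fin k → Fn} {x y} i → B i x y ≡ true → (∀ j → j ≢ i → B j x y ≡ false) →
  comb γ B x y ≡ γ i
comb-delta {suc k} γ fz B≡true others = trans
  (cong₂ _xor_ (trans (cong (γ fz ∧_) B≡true) (∧-identityʳ (γ fz))) (comb-zero (γ ∘ fs) (λ j → others (fs j) (λ ()))))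
  (xor-identityʳ (γ fz))
comb-delta {suc k} γ (fs i) B≡true others =
  cong₂ _xor_ (trans (cong (γ fz ∧_) (others fz (λ ()))) (∧-zeroʳ (γ fz)))
              (comb-delta (γ ∘ fs) i B≡true (λ j j≢i → others (fs j) (j≢i ∘ Fin.suc-injective)))

comb-xor : ∀ {k} (γ : Fin k → Bool) (B B′ : Fin k → Fn) x y →
  comb γ (λ i x y → B i x y xor B′ i x y) x y ≡ comb γ B x y xor comb γ B′ x y
comb-xor {zero} γ B B′ x y = refl
comb-xor {suc k} γ B B′ x y = begin
  (γ fz ∧ (B fz x y xor B′ fz x y)) xor comb (γ ∘ fs) (λ i x y → B (fs i) x y xor B′ (fs i) x y) x y
    ≡⟨ cong₂ _xor_ (∧-distribˡ-xor (γ fz) (B fz x y) (B′ fz x y)) (comb-xor (γ ∘ fs) (B ∘ fs) (B′ ∘ fs) x y) ⟩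
  ((γ fz ∧ B fz x y) xor (γ fz ∧ B′ fz x y)) xor (comb (γ ∘ fs) (B ∘ fs) x y xor comb (γ ∘ fs) (B′ ∘ fs) x y)
    ≡⟨ interchange (γ fz ∧ B fz x y) (γ fz ∧ B′ fz x y)
                   (comb (γ ∘ fs) (B ∘ fs) x y) (comb (γ ∘ fs) (B′ ∘ fs) x y) ⟩
  comb γ B x y xor comb γ B′ x y ∎
  where open ≡-Reasoning

comb-∧ˡ : ∀ {k} (γ : Fin k → Bool) (P : Fn) (B : Fin k → Fn) x y →
  comb γ (λ i x y → P x y ∧ B i x y) x y ≡ P x y ∧ comb γ B x y
comb-∧ˡ {zero} γ P B x y = sym (∧-zeroʳ (P x y))
comb-∧ˡ {suc k} γ P B x y = begin
  (γ fz ∧ (P x y ∧ B fz x y)) xor comb (γ ∘ fs) (λ i x y → P x y ∧ B (fs i) x y) x y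
    ≡⟨ cong₂ _xor_ (∧-exchange (γ fz) (P x y) (B fz x y)) (comb-∧ˡ (γ ∘ fs) P (B ∘ fs) x y) ⟩
  (P x y ∧ (γ fz ∧ B fz x y)) xor (P x y ∧ comb (γ ∘ fs) (B ∘ fs) x y)
    ≡⟨ ∧-distribˡ-xor (P x y) _ _ ⟨
  P x y ∧ comb γ B x y ∎
  where
  open ≡-Reasoning
  ∧-exchange : ∀ a b c → a ∧ (b ∧ c) ≡ b ∧ (a ∧ c)
  ∧-exchange a b c = trans (sym (∧-assoc a b c)) (trans (cong (_∧ c) (∧-comm a b)) (∧-assoc b a c))


≡ᵇ≡false : ∀ {m n} → m ≢ n → (m ≡ᵇ n) ≡ false
≡ᵇ≡false {m} {n} m≢n with m ≡ᵇ n in eq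
... | true = contradiction (Equivalence.to ≡ᵇ≡true⇔≡ eq) m≢n
... | false = refl

<⌊n/2⌋⇔2+2i≤n : ∀ {i} n → i < ⌊ n /2⌋ ⇔ 2 + 2 * i ≤ n
<⌊n/2⌋⇔2+2i≤n n = mk⇔ (to n) (from n)
  where
  2[1+i] : ∀ i → 2 + 2 * suc i ≡ 2 + (2 + 2 * i)
  2[1+i] i = cong (λ k → 2 + k) (*-suc 2 i)
  to : ∀ {i} n → i < ⌊ n /2⌋ → 2 + 2 * i ≤ n
  to {zero}  (suc (suc n)) _ = s≤s (s≤s z≤n)
  to {suc i} (suc (suc n)) (s≤s i<) = subst (_≤ 2 + n) (sym (2[1+i] i)) (s≤s (s≤s (to n i<)))
  from : ∀ {i} n → 2 + 2 * i ≤ n → i < ⌊ n /2⌋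
  from {zero}  (suc (suc n)) _ = s≤s z≤n
  from (suc zero) (s≤s ())
  from {suc i} (suc (suc n)) le = s≤s (from n (≤-pred (≤-pred (subst (_≤ 2 + n) (2[1+i] i) le))))

-- The number of t ≡ s (mod 2) with s < t ≤ c + 1.
dimension : ℕ → ℕ → ℕ
dimension s c = ⌊ (suc c ∸ s) /2⌋

module _ (m n s : ℕ) (s≤1 : s ≤ 1) where

  private
    c β : ℕ
    c = cOf m n
    β = dimension s c

  target : Fin β → ℕ
  target i = s + (2 + 2 * toℕ i)

  private
    s≤1+c : s ≤ suc c
    s≤1+c = ≤-trans s≤1 (s≤s z≤n)

    index-bound : ∀ {i} → i < β ⇔ s + (2 + 2 * i) ≤ suc c
    index-bound {i} = mk⇔
      (λ i<β → subst (s + (2 + 2 * i) ≤_) (m+[n∸m]≡n s≤1+c)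
                 (+-monoʳ-≤ s (Equivalence.to (<⌊n/2⌋⇔2+2i≤n (suc c ∸ s)) i<β)))
      (λ le → Equivalence.from (<⌊n/2⌋⇔2+2i≤n (suc c ∸ s)) (subst (_≤ suc c ∸ s) (m+n∸m≡n s _) (∸-monoˡ-≤ s le)))

    target-≤ : ∀ i → target i ≤ suc c
    target-≤ i = Equivalence.to index-bound (Fin.toℕ<n i)

    target-injective : ∀ {i j} → target i ≡ target j → i ≡ j
    target-injective eq = Fin.toℕ-injective (*-cancelˡ-≡ _ _ 2 (suc-injective (suc-injective (+-cancelˡ-≡ s _ _ eq))))

    1+c∣1+m : suc c ∣ suc m
    1+c∣1+m = subst (_∣ suc m) (sym (suc[cOf]≡gcd m n)) (gcd[m,n]∣m (suc m) (suc n))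

    1+c∣1+n : suc c ∣ suc n
    1+c∣1+n = subst (_∣ suc n) (sym (suc[cOf]≡gcd m n)) (gcd[m,n]∣n (suc m) (suc n))

    target≢s : ∀ i → target i ≢ s
    target≢s i eq with +-cancelˡ-≡ s _ 0 (trans eq (sym (+-identityʳ s)))
    ... | ()

  indicator : Fin β → ℤ → Bool
  indicator j z = fold c ∣ z ∣ ≡ᵇ target j

  basis : Fin β → Fn
  basis j = colourPart s (restrict m n (dAlembertGrid (indicator j)))

  basis-ker : ∀ j → Ker s m n (basis j)
  basis-ker j = harmonic⇒ker-colourPart s≤1 (restrict-dAlembert-harmonic indicator-even
    (symmetricAbout-dividing indicator-even indicator-symmetric 1+c∣1+m)
    (symmetricAbout-dividing indicator-even indicator-symmetric 1+c∣1+n))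
    where
    indicator-even : SymmetricAbout (indicator j) 0ℤ
    indicator-even = symmetricAbout-∘ (_≡ᵇ target j) (evenExtension-even (fold c))
    indicator-symmetric : SymmetricAbout (indicator j) (+ suc c)
    indicator-symmetric = symmetricAbout-∘ (_≡ᵇ target j) (fold-symmetric c)

  private
    diagonal-colour : ∀ h → colour (s + h) h ≡ s
    diagonal-colour h = trans (cong (_% 2) (shuffle s h)) (trans ([m+kn]%n≡m%n s h 2) (s%2≡s s≤1))
      where
      shuffle : ∀ s h → s + h + h ≡ s + h * 2
      shuffle = solve-∀
      s%2≡s : ∀ {s} → s ≤ 1 → s % 2 ≡ s
      s%2≡s z≤n = refl
      s%2≡s (s≤s z≤n) = refl

    2+s+h≤target : ∀ i → 2 + (s + toℕ i) ≤ target i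
    2+s+h≤target i = ≤-trans (m≤m+n (2 + (s + h)) h) (≤-reflexive (shuffle s h))
      where
      h : ℕ
      h = toℕ i
      shuffle : ∀ s h → 2 + (s + h) + h ≡ s + (2 + 2 * h)
      shuffle = solve-∀

  basis-at-index : ∀ i j → basis j (s + toℕ i) (toℕ i) ≡ (target i ≡ᵇ target j)
  basis-at-index i j = begin
    basis j (s + h) h
      ≡⟨ cong₂ _∧_ (Equivalence.from ≡ᵇ≡true⇔≡ (diagonal-colour h))
                   (cong (_∧ dAlembertGrid (indicator j) (suc (s + h)) (suc h)) inside) ⟩
    indicator j (+ (suc (s + h) + suc h)) xor indicator j (suc (s + h) ⊖ suc h)
      ≡⟨ cong₂ _xor_ (cong (_≡ᵇ target j) (trans (cong (fold c) (sum≡target s h)) (fold-id (target-≤ i))))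
                     (cong (_≡ᵇ target j) (trans (cong (fold c) difference≡s) (fold-id s≤1+c))) ⟩
    (target i ≡ᵇ target j) xor (s ≡ᵇ target j)
      ≡⟨ cong ((target i ≡ᵇ target j) xor_) (≡ᵇ≡false (λ eq → target≢s j (sym eq))) ⟩
    (target i ≡ᵇ target j) xor false
      ≡⟨ xor-identityʳ _ ⟩
    (target i ≡ᵇ target j) ∎
    where
    open ≡-Reasoning
    h : ℕ
    h = toℕ i
    sum≡target : ∀ s h → suc (s + h) + suc h ≡ s + (2 + 2 * h)
    sum≡target = solve-∀
    difference≡s : ∣ suc (s + h) ⊖ suc h ∣ ≡ s
    difference≡s = trans (cong ∣_∣ (trans (ℤ.[1+m]⊖[1+n]≡m⊖n (s + h) h) (ℤ.⊖-≥ (m≤n+m h s)))) (m+n∸n≡m s h)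
    inside : inR 0 0 m n (s + h) h ≡ true
    inside = inR-origin-intro {m} {n}
      (≤-pred (≤-trans (2+s+h≤target i) (≤-trans (target-≤ i) (∣⇒≤ 1+c∣1+m))))
      (≤-pred (≤-trans (s≤s (s≤s (m≤n+m h s))) (≤-trans (2+s+h≤target i) (≤-trans (target-≤ i) (∣⇒≤ 1+c∣1+n)))))

  basis-independent : ∀ (γ : Fin β → Bool) → (∀ x y → comb γ basis x y ≡ false) → ∀ i → γ i ≡ false
  basis-independent γ vanishes i = trans
    (sym (comb-delta γ i (trans (basis-at-index i i) (Equivalence.from (≡ᵇ≡true⇔≡ {target i}) refl))
           (λ j j≢i → trans (basis-at-index i j) (≡ᵇ≡false (λ eq → j≢i (sym (target-injective eq)))))))
    (vanishes (s + toℕ i) (toℕ i))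

  -- On colour s, dAlembert Φ sees Φ only at integers ≡ s (mod 2), that is, through their folds
  -- s and target j; and it does not change when the constant Φ s is added to all of them.
  module _ {Φ : ℤ → Bool} (even : SymmetricAbout Φ 0ℤ) (symmetric : SymmetricAbout Φ (+ suc c)) where

    coefficients : Fin β → Bool
    coefficients j = Φ (+ target j) xor Φ (+ s)

    private
      Φ-fold : ∀ z → Φ z ≡ Φ (+ fold c ∣ z ∣)
      Φ-fold = fold-invariant even symmetric

    indicator-combination : ∀ z → ∣ z ∣ % 2 ≡ s → ∀ {B x y} → (∀ j → B j x y ≡ indicator j z) →
      comb coefficients B x y ≡ Φ z xor Φ (+ s)
    indicator-combination z parity {B} B≡ with parity-split (trans (fold-%2 c ∣ z ∣) parity)
    ... | inj₁ f≡s = trans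
      (comb-zero coefficients (λ j → trans (B≡ j) (≡ᵇ≡false (λ eq → target≢s j (trans (sym eq) f≡s)))))
      (sym (≡⇒xor≡false (trans (Φ-fold z) (cong (Φ ∘ +_) f≡s))))
    ... | inj₂ (h , f≡) = trans
      (comb-delta coefficients ι (trans (B≡ ι) (Equivalence.from ≡ᵇ≡true⇔≡ (sym target≡f)))
        (λ j j≢ι → trans (B≡ j) (≡ᵇ≡false (λ eq → j≢ι (target-injective (trans (sym eq) (sym target≡f)))))))
      (cong (_xor Φ (+ s)) (trans (cong (Φ ∘ +_) target≡f) (sym (Φ-fold z))))
      where
      h<β : h < β
      h<β = Equivalence.from index-bound (subst (_≤ suc c) f≡ (fold-≤ c ∣ z ∣))
      ι : Fin β
      ι = fromℕ< h<β
      target≡f : target ι ≡ fold c ∣ z ∣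
      target≡f = trans (cong (λ k → s + (2 + 2 * k)) (Fin.toℕ-fromℕ< h<β)) (sym f≡)

    dAlembert-combination : ∀ x y → colour x y ≡ s →
      comb coefficients (λ j x y → dAlembertGrid (indicator j) (suc x) (suc y)) x y ≡ dAlembertGrid Φ (suc x) (suc y)
    dAlembert-combination x y colour≡s = begin
      comb coefficients (λ j x y → dAlembertGrid (indicator j) (suc x) (suc y)) x y
        ≡⟨ comb-xor coefficients (λ j x y → indicator j (+ (suc x + suc y))) (λ j x y → indicator j (suc x ⊖ suc y)) x y ⟩
      comb coefficients (λ j x y → indicator j (+ (suc x + suc y))) x y
        xor comb coefficients (λ j x y → indicator j (suc x ⊖ suc y)) x y
        ≡⟨ cong₂ _xor_ (indicator-combination (+ (suc x + suc y)) (trans (%2-suc-+-suc x y) colour≡s) (λ _ → refl))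
                       (indicator-combination (suc x ⊖ suc y)
                          (trans (∣⊖∣-%2 (suc x) (suc y)) (trans (%2-suc-+-suc x y) colour≡s)) (λ _ → refl)) ⟩
      (Φ (+ (suc x + suc y)) xor Φ (+ s)) xor (Φ (suc x ⊖ suc y) xor Φ (+ s))
        ≡⟨ xor-cancel-common (Φ (+ (suc x + suc y))) (Φ (suc x ⊖ suc y)) (Φ (+ s)) ⟩
      dAlembertGrid Φ (suc x) (suc y) ∎
      where open ≡-Reasoning

  basis-spans : ∀ u → Ker s m n u → ∃ λ (γ : Fin β → Bool) → ∀ x y → u x y ≡ comb γ basis x y
  basis-spans u ker = coefficients even (symmetric-c harmonic) , λ x y → begin
    u x y
      ≡⟨ colourPart-ker {m} {n} ker x y ⟨
    (colour x y ≡ᵇ s) ∧ u x y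
      ≡⟨ cong ((colour x y ≡ᵇ s) ∧_) (v≡restrict harmonic x y) ⟩
    (colour x y ≡ᵇ s) ∧ (inR 0 0 m n x y ∧ dAlembertGrid Φ (suc x) (suc y))
      ≡⟨ ∧-congˡ-if (λ colour≡s → cong (inR 0 0 m n x y ∧_)
           (sym (dAlembert-combination even (symmetric-c harmonic) x y (Equivalence.to ≡ᵇ≡true⇔≡ colour≡s)))) ⟩
    (colour x y ≡ᵇ s) ∧ (inR 0 0 m n x y ∧ comb γ (λ j x y → dAlembertGrid (indicator j) (suc x) (suc y)) x y)
      ≡⟨ cong ((colour x y ≡ᵇ s) ∧_)
           (comb-∧ˡ γ (inR 0 0 m n) (λ j x y → dAlembertGrid (indicator j) (suc x) (suc y)) x y) ⟨
    (colour x y ≡ᵇ s) ∧ comb γ (λ j → restrict m n (dAlembertGrid (indicator j))) x y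
      ≡⟨ comb-∧ˡ γ (λ x y → colour x y ≡ᵇ s) (λ j → restrict m n (dAlembertGrid (indicator j))) x y ⟨
    comb γ basis x y ∎
    where
    open ≡-Reasoning
    harmonic : Harmonic m n u
    harmonic = ker⇒harmonic {m} {n} s≤1 ker
    open DAlembertForm (harmonic⇒dAlembertForm harmonic)
    γ : Fin β → Bool
    γ = coefficients even (symmetric-c harmonic)

  ker-dimension : IsDim (Ker s m n) β
  ker-dimension = basis , basis-ker , basis-independent , basis-spans

cOf-idem : ∀ c → cOf c c ≡ c
cOf-idem c = cong (_∸ 1) (GCD.unique (gcd-GCD (suc c) (suc c)) GCD.refl)

kernel-dimensions : ∀ m n s → s ≤ 1 →
  ∃ λ β → IsDim (Ker s m n) β × IsDim (Ker s (cOf m n) (cOf m n)) β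
kernel-dimensions m n s s≤1 = dimension s c , ker-dimension m n s s≤1
  , subst (λ k → IsDim (Ker s c c) (dimension s k)) (cOf-idem c) (ker-dimension c c s s≤1)
  where
  c : ℕ
  c = cOf m n

theorem3 : ∀ (m n : ℕ) → 1 ≤ m → 1 ≤ n →
    (∀ v → KerBW m n v → Props 1 m n (cOf m n) v)
    × (∀ v → KerWB m n v → Props 0 m n (cOf m n) v)
    × (∃ λ β → IsDim (KerBW m n) β × IsDim (KerBW (cOf m n) (cOf m n)) β)
    × (∃ λ ω → IsDim (KerWB m n) ω × IsDim (KerWB (cOf m n) (cOf m n)) ω)
theorem3 m n _ _ =
    (λ v ker → props (ker⇒harmonic {m} {n} z≤n ker) 1)
  , (λ v ker → props (ker⇒harmonic {m} {n} (s≤s z≤n) ker) 0)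
  , kernel-dimensions m n 0 z≤n
  , kernel-dimensions m n 1 (s≤s z≤n)
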